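{- Let $\Gamma$ be a numerical semigroup with multiplicity $m$. Then: (1) $\Gamma=\mathbb{N}$ if and only if $W_\Gamma(k)\ge 0$ for all $1\le k\le m$. (2) $\Gamma=\langle m,qm+1,\ldots,qm+(m-1)\rangle$ for some integer $q\ge 1$ if and only if $W_\Gamma(k)\le 0$ for all $1\le k\le m$. (3) Among the numerical semigroups $\Gamma\neq\mathbb{N}$ satisfying $W_\Gamma(k)\ge0$ for all $2\le k\le m(\Gamma)$ and $W_\Gamma(2)=0$, those of minimal embedding dimension are exactly the semigroups $\langle a,b\rangle$ with $a,b\ge 2$ and $\gcd(a,b)=1$.
   Context: A numerical semigroup is an additive submonoid $\Gamma\subseteq\mathbb{N}$ with finite complement; $\langle x_1,\dots,x_s\rangle$ denotes the submonoid generated by $x_1,\dots,x_s$. The multiplicity is $m=\min(\Gamma\setminus\{0\})$, the embedding dimension $e(\Gamma)$ is the cardinality of the minimal system of generators, the conductor $c(\Gamma)$ is one more than the largest integer not in $\Gamma$ (so $c(\mathbb{N})=0$), and $\delta(\Gamma)=|\{x\in\Gamma:x<c(\Gamma)\}|$. The Wilf function is $W_\Gamma(k)=k\delta(\Gamma)-c(\Gamma)$ for $k\in\mathbb{N}$. -}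

module Defs where

open import Data.Bool using (Bool; true; false; if_then_else_)
open import Data.Nat using (ℕ; zero; suc; _+_; _*_; _∸_; _≤_)
open import Data.Integer using (ℤ; +_; _-_)
open import Data.List using (List; []; _∷_; map; upTo)
open import Data.List.Membership.Propositional using (_∈_)
open import Data.Product using (_×_)
open import Relation.Binary.PropositionalEquality using (_≡_)

-- A numerical semigroup, given by its (Boolean) membership function.
-- Every subset of ℕ with finite complement is decidable, so nothing is lost.
record NumericalSemigroup : Set where
  field
    mem       : ℕ → Bool
    mem-zero  : mem 0 ≡ true
    mem-add   : ∀ x y → mem x ≡ true → mem y ≡ true → mem (x + y) ≡ true
    bound     : ℕ
    mem-above : ∀ n → bound ≤ n → mem n ≡ true
open NumericalSemigroup public

_∈Γ_ : ℕ → NumericalSemigroup → Set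
n ∈Γ Γ = mem Γ n ≡ true

data InGen (gs : List ℕ) : ℕ → Set where
  gen-zero : InGen gs 0
  gen-step : ∀ {g n} → g ∈ gs → InGen gs n → InGen gs (g + n)

_≐⟨_⟩ : NumericalSemigroup → List ℕ → Set
Γ ≐⟨ gs ⟩ = ∀ n → (n ∈Γ Γ → InGen gs n) × (InGen gs n → n ∈Γ Γ)

IsWhole : NumericalSemigroup → Set
IsWhole Γ = ∀ n → n ∈Γ Γ

condBelow : NumericalSemigroup → ℕ → ℕ
condBelow Γ zero = zero
condBelow Γ (suc n) = if mem Γ n then condBelow Γ n else suc n

-- conductor c(Γ): all gaps lie below `bound`
conductor : NumericalSemigroup → ℕ
conductor Γ = condBelow Γ (bound Γ)

countBelow : (ℕ → Bool) → ℕ → ℕ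
countBelow p zero = zero
countBelow p (suc n) = if p n then suc (countBelow p n) else countBelow p n

δ : NumericalSemigroup → ℕ
δ Γ = countBelow (mem Γ) (conductor Γ)

W : NumericalSemigroup → ℕ → ℤ
W Γ k = + (k * δ Γ) - + conductor Γ

findFrom : NumericalSemigroup → ℕ → ℕ → ℕ
findFrom Γ zero s = s
findFrom Γ (suc f) s = if mem Γ s then s else findFrom Γ f (suc s)

-- multiplicity m(Γ) = min (Γ \ {0}); bound+1 ∈ Γ, so searching 1..bound+1 suffices
multiplicity : NumericalSemigroup → ℕ
multiplicity Γ = findFrom Γ (bound Γ) 1

splitsUpTo : NumericalSemigroup → ℕ → ℕ → Bool
splitsUpTo Γ n zero = false
splitsUpTo Γ n (suc k) =
  if mem Γ (suc k) then (if mem Γ (n ∸ suc k) then true else splitsUpTo Γ n k)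
  else splitsUpTo Γ n k

isMinGen : NumericalSemigroup → ℕ → Bool
isMinGen Γ zero = false
isMinGen Γ (suc n) = if mem Γ (suc n) then (if splitsUpTo Γ (suc n) n then false else true) else false

-- embedding dimension: number of minimal generators; they are all < c(Γ) + m(Γ)
embeddingDimension : NumericalSemigroup → ℕ
embeddingDimension Γ = countBelow (isMinGen Γ) (conductor Γ + multiplicity Γ)

arfGens : ℕ → ℕ → List ℕ
arfGens m q = m ∷ map (λ i → q * m + suc i) (upTo (m ∸ 1))

-- Let c be the conductor, δ the number of elements of Γ below c, and m the multiplicity.
-- (1) If Γ ≠ ℕ then c − 1 is a gap, so δ < c and W(1) < 0.
-- (2) The multiples 0, m, 2m, … of m are elements, so m δ ≤ c holds only if c = qm and the multiples of
--     m are the only elements below c, which is exactly Γ = ⟨m, qm + 1, …, qm + m − 1⟩.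
-- (3) A semigroup Γ ≠ ℕ has at least two minimal generators (the multiplicity alone would give Γ ⊆ mℕ),
--     and ℕ ∖ {1} = ⟨2, 3⟩ satisfies the hypotheses, so the minimal embedding dimension is 2. A
--     semigroup ⟨a, b⟩ contains c and c + 1, so gcd(a, b) = 1; conversely such a ⟨a, b⟩ is symmetric
--     (Sylvester: x ∈ Γ iff ab − a − b − x ∉ Γ), hence 2δ = c, i.e. W(2) = 0 and W(k) ≥ 0 for k ≥ 2.

module Submission where

open import Defs
open import Data.Bool using (Bool; true; false; if_then_else_; not; T)
open import Data.Empty using (⊥-elim)
open import Data.Integer using (+_; +≤+) renaming (_≤_ to _≤ℤ_)
open import Data.Integer.Properties
  using (i≤j⇒0≤j-i; 0≤i-j⇒j≤i; i≤j⇒i-j≤0; i-j≤0⇒i≤j; drop‿+≤+; i≡j⇒i-j≡0)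
open import Data.List using ([]; _∷_)
open import Data.List.Membership.Propositional using (_∈_)
open import Data.List.Membership.Propositional.Properties using (∈-map⁺; ∈-map⁻; ∈-upTo⁺)
open import Data.List.Relation.Unary.Any using (here; there)
open import Data.Nat
open import Data.Nat.Coprimality using (Coprime; coprime-Bézout; coprime-divisor; gcd≡1⇒coprime)
open import Data.Nat.DivMod
open import Data.Nat.Divisibility
open import Data.Nat.GCD using (gcd; gcd[m,n]∣m; gcd[m,n]∣n; module Bézout)
open import Data.Nat.Induction using (<-rec)
open import Data.Nat.Properties
open import Data.Nat.Tactic.RingSolver using (solve-∀)
open import Data.Product using (_×_; _,_; ∃; ∃₂; proj₁; proj₂)
open import Data.Sum using (_⊎_; inj₁; inj₂; [_,_]′)
open import Function using (id; _∘_)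
open import Function.Bundles using (_⇔_; mk⇔; Equivalence)
open import Relation.Nullary using (¬_; yes; no)
open import Relation.Binary.PropositionalEquality

countBelow-≤ : ∀ p n → countBelow p n ≤ n
countBelow-≤ p zero = z≤n
countBelow-≤ p (suc n) with p n
... | true = s≤s (countBelow-≤ p n)
... | false = m≤n⇒m≤1+n (countBelow-≤ p n)

countBelow-mono : ∀ p {m n} → m ≤ n → countBelow p m ≤ countBelow p n
countBelow-mono p {n = zero} z≤n = z≤n
countBelow-mono p {n = suc n} m≤1+n with m≤n⇒m<n∨m≡n m≤1+n
... | inj₂ refl = ≤-refl
... | inj₁ m<1+n with p n
...   | true = m≤n⇒m≤1+n (countBelow-mono p (≤-pred m<1+n))
...   | false = countBelow-mono p (≤-pred m<1+n)

countBelow-hit : ∀ p {x n} → x < n → p x ≡ true → suc (countBelow p x) ≤ countBelow p n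
countBelow-hit p {x} x<n px = ≤-trans (≤-reflexive (sym step)) (countBelow-mono p x<n)
  where
  step : countBelow p (suc x) ≡ suc (countBelow p x)
  step rewrite px = refl

countBelow-cong : ∀ p q n → (∀ x → x < n → p x ≡ q x) → countBelow p n ≡ countBelow q n
countBelow-cong p q zero _ = refl
countBelow-cong p q (suc n) p≗q
  with p n | q n | p≗q n ≤-refl | countBelow-cong p q n (λ x x<n → p≗q x (m<n⇒m<1+n x<n))
... | true  | true  | _ | eq = cong suc eq
... | false | false | _ | eq = eq

countBelow-+ : ∀ p m k → countBelow p (m + k) ≡ countBelow p m + countBelow (λ x → p (m + x)) k
countBelow-+ p m zero rewrite +-identityʳ m = sym (+-identityʳ _)
countBelow-+ p m (suc k) rewrite +-suc m k with p (m + k) | countBelow-+ p m k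
... | true  | eq = trans (cong suc eq) (sym (+-suc _ _))
... | false | eq = eq

countBelow-reverse : ∀ p n → countBelow p n ≡ countBelow (λ x → p (n ∸ suc x)) n
countBelow-reverse p zero = refl
countBelow-reverse p (suc n) with countBelow-+ (λ x → p (suc n ∸ suc x)) 1 n | countBelow-reverse p n
... | split | ih with p n
...   | true = trans (cong suc ih) (sym split)
...   | false = trans ih (sym split)

countBelow-not : ∀ p n → countBelow p n + countBelow (λ x → not (p x)) n ≡ n
countBelow-not p zero = refl
countBelow-not p (suc n) with p n | countBelow-not p n
... | true  | eq = cong suc eq
... | false | eq = trans (+-suc _ _) (cong suc eq)

countBelow-witness : ∀ p n → 1 ≤ countBelow p n → ∃ λ x → x < n × p x ≡ true
countBelow-witness p (suc n) pos with p n in pn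
... | true = n , ≤-refl , pn
... | false with countBelow-witness p n pos
...   | x , x<n , px = x , m<n⇒m<1+n x<n , px

countBelow≡0⇒¬p : ∀ p n → countBelow p n ≡ 0 → ∀ x → x < n → p x ≢ true
countBelow≡0⇒¬p p n none x x<n px with subst (suc (countBelow p x) ≤_) none (countBelow-hit p x<n px)
... | ()

¬p⇒countBelow≡0 : ∀ p n → (∀ x → x < n → p x ≢ true) → countBelow p n ≡ 0
¬p⇒countBelow≡0 p zero _ = refl
¬p⇒countBelow≡0 p (suc n) none with p n in pn
... | true = ⊥-elim (none n ≤-refl pn)
... | false = ¬p⇒countBelow≡0 p n (λ x x<n → none x (m<n⇒m<1+n x<n))

countBelow-≤1 : ∀ p a n → (∀ x → x < n → p x ≡ true → x ≡ a) → countBelow p n ≤ 1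
countBelow-≤1 p a zero _ = z≤n
countBelow-≤1 p a (suc n) only with p n in pn
... | false = countBelow-≤1 p a n (λ x x<n → only x (m<n⇒m<1+n x<n))
... | true with only n ≤-refl pn
...   | refl = s≤s (≤-reflexive (¬p⇒countBelow≡0 p n λ x x<n px →
                    <⇒≢ x<n (only x (m<n⇒m<1+n x<n) px)))

countBelow-≤2 : ∀ p a b n → (∀ x → x < n → p x ≡ true → x ≡ a ⊎ x ≡ b) → countBelow p n ≤ 2
countBelow-≤2 p a b zero _ = z≤n
countBelow-≤2 p a b (suc n) only with p n in pn
... | false = countBelow-≤2 p a b n (λ x x<n → only x (m<n⇒m<1+n x<n))
... | true with only n ≤-refl pn
...   | inj₁ refl = s≤s (countBelow-≤1 p b n λ x x<n px →
                      [ ⊥-elim ∘ <⇒≢ x<n , id ]′ (only x (m<n⇒m<1+n x<n) px))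
...   | inj₂ refl = s≤s (countBelow-≤1 p a n λ x x<n px →
                      [ id , ⊥-elim ∘ <⇒≢ x<n ]′ (only x (m<n⇒m<1+n x<n) px))

remove : (ℕ → Bool) → ℕ → ℕ → Bool
remove p a x = if x ≡ᵇ a then false else p x

≡ᵇ-refl : ∀ a → (a ≡ᵇ a) ≡ true
≡ᵇ-refl a with a ≡ᵇ a | ≡⇒≡ᵇ a a refl
... | true | _ = refl

remove-other : ∀ p {a x} → x ≢ a → remove p a x ≡ p x
remove-other p {a} {x} x≢a with x ≡ᵇ a in e
... | false = refl
... | true = ⊥-elim (x≢a (≡ᵇ⇒≡ x a (subst T (sym e) _)))

remove-true : ∀ p {a x} → remove p a x ≡ true → x ≢ a × p x ≡ true
remove-true p {a} {x} r with x ≟ a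
... | yes refl rewrite ≡ᵇ-refl a with () ← r
... | no x≢a = x≢a , trans (sym (remove-other p x≢a)) r

countBelow-remove : ∀ p {a n} → a < n → p a ≡ true → countBelow p n ≡ suc (countBelow (remove p a) n)
countBelow-remove p {a} {suc n} a<1+n pa with a ≟ n
... | yes refl rewrite ≡ᵇ-refl a | pa =
  cong suc (countBelow-cong p (remove p a) a (λ x x<a → sym (remove-other p (<⇒≢ x<a))))
... | no a≢n rewrite remove-other p {a} {n} (a≢n ∘ sym)
  with p n | countBelow-remove p (≤∧≢⇒< (≤-pred a<1+n) a≢n) pa
...   | true  | eq = cong suc eq
...   | false | eq = eq

countBelow-remove≡0 : ∀ p a n → countBelow (remove p a) n ≡ 0 → ∀ {x} → x < n → p x ≡ true → x ≡ a
countBelow-remove≡0 p a n none {x} x<n px with x ≟ a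
... | yes x≡a = x≡a
... | no x≢a = ⊥-elim (countBelow≡0⇒¬p (remove p a) n none x x<n (trans (remove-other p x≢a) px))

∣∧<⇒≡0 : ∀ {N x} → x < N → N ∣ x → x ≡ 0
∣∧<⇒≡0 {x = zero} _ _ = refl
∣∧<⇒≡0 {x = suc x} x<N N∣x = ⊥-elim (>⇒∤ x<N N∣x)

module _ (N : ℕ) .{{_ : NonZero N}} where

  countBelow-multiples-≤ : ∀ p t → (∀ {x} → x < t * N → p x ≡ true → N ∣ x) →
                           countBelow p (t * N) ≤ t
  countBelow-multiples-≤ p zero _ = z≤n
  countBelow-multiples-≤ p (suc t) onlyMultiples rewrite countBelow-+ p N (t * N) = +-mono-≤
    (countBelow-≤1 p 0 N λ x x<N px → ∣∧<⇒≡0 x<N (onlyMultiples (<-≤-trans x<N (m≤m+n N (t * N))) px))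
    (countBelow-multiples-≤ (λ x → p (N + x)) t λ x<tN px →
       ∣m+n∣m⇒∣n (onlyMultiples (+-monoʳ-< N x<tN) px) ∣-refl)

  countBelow-multiples-≥ : ∀ p → (∀ i → p (i * N) ≡ true) → ∀ l → l ≤ countBelow p (l * N)
  countBelow-multiples-≥ p multiples zero = z≤n
  countBelow-multiples-≥ p multiples (suc l) rewrite countBelow-+ p N (l * N) = +-mono-≤
    (countBelow-hit p (>-nonZero⁻¹ N) (multiples 0))
    (countBelow-multiples-≥ (λ x → p (N + x)) (λ i → multiples (suc i)) l)

  countBelow-multiples-> : ∀ p → (∀ i → p (i * N) ≡ true) →
                           ∀ {j n} → j * N < n → suc j ≤ countBelow p n
  countBelow-multiples-> p multiples {j} jN<n =
    ≤-trans (s≤s (countBelow-multiples-≥ p multiples j)) (countBelow-hit p jN<n (multiples j))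

  countBelow-multiples-nonmultiple : ∀ p → (∀ i → p (i * N) ≡ true) →
    ∀ l {y} → y < l * N → p y ≡ true → ¬ N ∣ y → suc l ≤ countBelow p (l * N)
  countBelow-multiples-nonmultiple p multiples (suc l) {y} y<N+lN py N∤y
    rewrite countBelow-+ p N (l * N) with y <? N
  ... | yes y<N = +-mono-≤ {2} (≤-trans (s≤s 1≤count) (countBelow-hit p y<N py))
                          (countBelow-multiples-≥ (λ x → p (N + x)) (λ i → multiples (suc i)) l)
    where
    1≤count : 1 ≤ countBelow p y
    1≤count = countBelow-hit p {0} {y} (n≢0⇒n>0 λ { refl → N∤y (N ∣0) }) (multiples 0)
  ... | no y≮N with m≤n⇒∃[o]m+o≡n (≮⇒≥ y≮N)
  ...   | y′ , refl = +-mono-≤ {1} (countBelow-hit p (>-nonZero⁻¹ N) (multiples 0))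
          (countBelow-multiples-nonmultiple (λ x → p (N + x)) (λ i → multiples (suc i)) l
            (+-cancelˡ-< N y′ (l * N) y<N+lN) py (λ N∣y′ → N∤y (∣m∣n⇒∣m+n ∣-refl N∣y′)))

∈Γ-* : ∀ Γ {g} → g ∈Γ Γ → ∀ t → (t * g) ∈Γ Γ
∈Γ-* Γ g∈Γ zero = mem-zero Γ
∈Γ-* Γ g∈Γ (suc t) = mem-add Γ _ _ g∈Γ (∈Γ-* Γ g∈Γ t)

1∈Γ⇒whole : ∀ Γ → 1 ∈Γ Γ → IsWhole Γ
1∈Γ⇒whole Γ 1∈Γ n = subst (_∈Γ Γ) (*-identityʳ n) (∈Γ-* Γ 1∈Γ n)

condBelow-≤⇒∈Γ : ∀ Γ n {x} → condBelow Γ n ≤ x → x < n → x ∈Γ Γ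
condBelow-≤⇒∈Γ Γ (suc n) {x} c≤x x<1+n with mem Γ n in n∈Γ
... | false = ⊥-elim (<⇒≱ x<1+n c≤x)
... | true with m≤n⇒m<n∨m≡n (≤-pred x<1+n)
...   | inj₁ x<n = condBelow-≤⇒∈Γ Γ n c≤x x<n
...   | inj₂ refl = n∈Γ

conductor-≤⇒∈Γ : ∀ Γ {x} → conductor Γ ≤ x → x ∈Γ Γ
conductor-≤⇒∈Γ Γ {x} c≤x with x <? bound Γ
... | yes x<b = condBelow-≤⇒∈Γ Γ (bound Γ) c≤x x<b
... | no x≮b = mem-above Γ x (≮⇒≥ x≮b)

condBelow-gap : ∀ Γ n → condBelow Γ n ≡ 0 ⊎ ∃ λ k → condBelow Γ n ≡ suc k × mem Γ k ≡ false
condBelow-gap Γ zero = inj₁ refl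
condBelow-gap Γ (suc n) with mem Γ n in n∉Γ
... | true = condBelow-gap Γ n
... | false = inj₂ (n , refl , n∉Γ)

conductor-gap : ∀ Γ → conductor Γ ≡ 0 ⊎ ∃ λ k → conductor Γ ≡ suc k × mem Γ k ≡ false
conductor-gap Γ = condBelow-gap Γ (bound Γ)

conductor-least : ∀ Γ {c₀} → (∀ x → c₀ ≤ x → x ∈Γ Γ) → conductor Γ ≤ c₀
conductor-least Γ {c₀} above with conductor-gap Γ
... | inj₁ c≡0 rewrite c≡0 = z≤n
... | inj₂ (k , c≡1+k , k∉Γ) rewrite c≡1+k with k <? c₀
...   | yes k<c₀ = k<c₀
...   | no k≮c₀ with () ← trans (sym k∉Γ) (above k (≮⇒≥ k≮c₀))

conductor-≡ : ∀ Γ {k} → (∀ x → suc k ≤ x → x ∈Γ Γ) → mem Γ k ≡ false → conductor Γ ≡ suc k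
conductor-≡ Γ {k} above k∉Γ = ≤-antisym (conductor-least Γ above) (≮⇒≥ c≰k)
  where
  c≰k : ¬ conductor Γ < suc k
  c≰k c<1+k with () ← trans (sym k∉Γ) (conductor-≤⇒∈Γ Γ (≤-pred c<1+k))

conductor≡0⇒whole : ∀ Γ → conductor Γ ≡ 0 → IsWhole Γ
conductor≡0⇒whole Γ c≡0 n = conductor-≤⇒∈Γ Γ (subst (_≤ n) (sym c≡0) z≤n)

δ<conductor : ∀ Γ {k} → conductor Γ ≡ suc k → mem Γ k ≡ false → δ Γ < conductor Γ
δ<conductor Γ {k} c≡1+k k∉Γ = begin-strict
  δ Γ                        ≡⟨ cong (countBelow (mem Γ)) c≡1+k ⟩
  countBelow (mem Γ) (suc k) ≡⟨ skip ⟩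
  countBelow (mem Γ) k       ≤⟨ countBelow-≤ (mem Γ) k ⟩
  k                          <⟨ n<1+n k ⟩
  suc k                      ≡⟨ c≡1+k ⟨
  conductor Γ                ∎
  where
  open ≤-Reasoning
  skip : countBelow (mem Γ) (suc k) ≡ countBelow (mem Γ) k
  skip rewrite k∉Γ = refl

findFrom-≥ : ∀ Γ f s → s ≤ findFrom Γ f s
findFrom-≥ Γ zero s = ≤-refl
findFrom-≥ Γ (suc f) s with mem Γ s
... | true = ≤-refl
... | false = <⇒≤ (findFrom-≥ Γ f (suc s))

findFrom-∈Γ : ∀ Γ f s → findFrom Γ f s ∈Γ Γ ⊎ findFrom Γ f s ≡ s + f
findFrom-∈Γ Γ zero s = inj₂ (sym (+-identityʳ s))
findFrom-∈Γ Γ (suc f) s with mem Γ s in s∈Γ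
... | true = inj₁ s∈Γ
... | false with findFrom-∈Γ Γ f (suc s)
...   | inj₁ found = inj₁ found
...   | inj₂ end = inj₂ (trans end (sym (+-suc s f)))

findFrom-∉Γ : ∀ Γ f s {x} → s ≤ x → x < findFrom Γ f s → mem Γ x ≡ false
findFrom-∉Γ Γ zero s s≤x x<s = ⊥-elim (<⇒≱ x<s s≤x)
findFrom-∉Γ Γ (suc f) s {x} s≤x x<r with mem Γ s in s∈Γ
... | true = ⊥-elim (<⇒≱ x<r s≤x)
... | false with m≤n⇒m<n∨m≡n s≤x
...   | inj₁ s<x = findFrom-∉Γ Γ f (suc s) s<x x<r
...   | inj₂ refl = s∈Γ

multiplicity-pos : ∀ Γ → 1 ≤ multiplicity Γ
multiplicity-pos Γ = findFrom-≥ Γ (bound Γ) 1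

multiplicity-∈Γ : ∀ Γ → multiplicity Γ ∈Γ Γ
multiplicity-∈Γ Γ with findFrom-∈Γ Γ (bound Γ) 1
... | inj₁ found = found
... | inj₂ end = mem-above Γ _ (subst (bound Γ ≤_) (sym end) (n≤1+n _))

multiplicity-≤ : ∀ Γ {x} → 1 ≤ x → x ∈Γ Γ → multiplicity Γ ≤ x
multiplicity-≤ Γ {x} 1≤x x∈Γ = ≮⇒≥ x≮m
  where
  x≮m : ¬ x < multiplicity Γ
  x≮m x<m with () ← trans (sym (findFrom-∉Γ Γ (bound Γ) 1 1≤x x<m)) x∈Γ

multiplicity-nonZero : ∀ Γ → NonZero (multiplicity Γ)
multiplicity-nonZero Γ = >-nonZero (multiplicity-pos Γ)

¬whole⇒2≤multiplicity : ∀ Γ → ¬ IsWhole Γ → 2 ≤ multiplicity Γ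
¬whole⇒2≤multiplicity Γ ¬whole with multiplicity Γ | multiplicity-pos Γ | multiplicity-∈Γ Γ
... | 1 | _ | 1∈Γ = ⊥-elim (¬whole (1∈Γ⇒whole Γ 1∈Γ))
... | suc (suc _) | _ | _ = s≤s (s≤s z≤n)

<multiplicity⇒≡0 : ∀ Γ {x} → x < multiplicity Γ → x ∈Γ Γ → x ≡ 0
<multiplicity⇒≡0 Γ {zero} _ _ = refl
<multiplicity⇒≡0 Γ {suc x} x<m x∈Γ = ⊥-elim (<⇒≱ x<m (multiplicity-≤ Γ (s≤s z≤n) x∈Γ))

¬whole⇒1≤conductor : ∀ Γ → ¬ IsWhole Γ → 1 ≤ conductor Γ
¬whole⇒1≤conductor Γ ¬whole with conductor-gap Γ
... | inj₁ c≡0 = ⊥-elim (¬whole (conductor≡0⇒whole Γ c≡0))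
... | inj₂ (k , c≡1+k , _) = subst (1 ≤_) (sym c≡1+k) (s≤s z≤n)

0≤W⇔conductor≤kδ : ∀ Γ k → + 0 ≤ℤ W Γ k ⇔ conductor Γ ≤ k * δ Γ
0≤W⇔conductor≤kδ Γ k = mk⇔ (drop‿+≤+ ∘ 0≤i-j⇒j≤i) (i≤j⇒0≤j-i ∘ +≤+)

W≤0⇔kδ≤conductor : ∀ Γ k → W Γ k ≤ℤ + 0 ⇔ k * δ Γ ≤ conductor Γ
W≤0⇔kδ≤conductor Γ k = mk⇔ (drop‿+≤+ ∘ i-j≤0⇒i≤j) (i≤j⇒i-j≤0 ∘ +≤+)

whole⇔0≤W : ∀ Γ → IsWhole Γ ⇔ (∀ k → 1 ≤ k → k ≤ multiplicity Γ → + 0 ≤ℤ W Γ k)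
whole⇔0≤W Γ = mk⇔
  (λ whole k _ _ → Equivalence.from (0≤W⇔conductor≤kδ Γ k)
                     (≤-trans (conductor-least Γ λ x _ → whole x) z≤n))
  nonnegative⇒whole
  where
  nonnegative⇒whole : (∀ k → 1 ≤ k → k ≤ multiplicity Γ → + 0 ≤ℤ W Γ k) → IsWhole Γ
  nonnegative⇒whole 0≤W with conductor-gap Γ
  ... | inj₁ c≡0 = conductor≡0⇒whole Γ c≡0
  ... | inj₂ (k , c≡1+k , k∉Γ) = ⊥-elim (<⇒≱ (δ<conductor Γ c≡1+k k∉Γ)
          (subst (conductor Γ ≤_) (*-identityˡ (δ Γ))
            (Equivalence.to (0≤W⇔conductor≤kδ Γ 1) (0≤W 1 ≤-refl (multiplicity-pos Γ)))))

InGen-+ : ∀ {gs x y} → InGen gs x → InGen gs y → InGen gs (x + y)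
InGen-+ gen-zero y∈ = y∈
InGen-+ {gs} {y = y} (gen-step {g} {n} g∈gs n∈) y∈ =
  subst (InGen gs) (sym (+-assoc g n y)) (gen-step g∈gs (InGen-+ n∈ y∈))

InGen-* : ∀ {gs g} → g ∈ gs → ∀ t → InGen gs (t * g)
InGen-* g∈gs zero = gen-zero
InGen-* g∈gs (suc t) = gen-step g∈gs (InGen-* g∈gs t)

InGen-generator : ∀ {gs g} → g ∈ gs → InGen gs g
InGen-generator {gs} {g} g∈gs = subst (InGen gs) (+-identityʳ g) (gen-step g∈gs gen-zero)

InGen⇒∈Γ : ∀ Γ {gs} → (∀ {g} → g ∈ gs → g ∈Γ Γ) → ∀ {n} → InGen gs n → n ∈Γ Γ
InGen⇒∈Γ Γ gs⊆Γ gen-zero = mem-zero Γ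
InGen⇒∈Γ Γ gs⊆Γ (gen-step g∈gs n∈) = mem-add Γ _ _ (gs⊆Γ g∈gs) (InGen⇒∈Γ Γ gs⊆Γ n∈)

InGen-∣ : ∀ {d gs n} → (∀ {g} → g ∈ gs → d ∣ g) → InGen gs n → d ∣ n
InGen-∣ d∣gs gen-zero = _ ∣0
InGen-∣ d∣gs (gen-step g∈gs n∈) = ∣m∣n⇒∣m+n (d∣gs g∈gs) (InGen-∣ d∣gs n∈)

∣generators⇒∣1 : ∀ Γ {gs d} → (∀ {x} → x ∈Γ Γ → InGen gs x) → (∀ {g} → g ∈ gs → d ∣ g) →
                 d ∣ 1
∣generators⇒∣1 Γ Γ⊆ d∣gs =
  ∣m+n∣m⇒∣n (InGen-∣ d∣gs (Γ⊆ (conductor-≤⇒∈Γ Γ (m≤m+n _ 1))))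
            (InGen-∣ d∣gs (Γ⊆ (conductor-≤⇒∈Γ Γ ≤-refl)))

MultiplesBelowConductor : NumericalSemigroup → ℕ → Set
MultiplesBelowConductor Γ N = N ∣ conductor Γ × (∀ {x} → x < conductor Γ → x ∈Γ Γ → N ∣ x)

module _ (Γ : NumericalSemigroup) {N : ℕ} .{{_ : NonZero N}} where

  multiples⇒Nδ≤conductor : MultiplesBelowConductor Γ N → N * δ Γ ≤ conductor Γ
  multiples⇒Nδ≤conductor (divides t c≡tN , below) = begin
    N * δ Γ                                ≡⟨ cong (λ c → N * countBelow (mem Γ) c) c≡tN ⟩
    N * countBelow (mem Γ) (t * N)         ≤⟨ *-monoʳ-≤ N (countBelow-multiples-≤ N (mem Γ) t
                                                 λ x<tN → below (subst (_ <_) (sym c≡tN) x<tN)) ⟩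
    N * t                                  ≡⟨ *-comm N t ⟩
    t * N                                  ≡⟨ c≡tN ⟨
    conductor Γ                            ∎
    where open ≤-Reasoning

  -- Write c = r + jN with r < N. Then N δ ≤ c gives δ ≤ j, whereas the j multiples 0, N, …, (j − 1)N
  -- together with jN (when r > 0) or with a non-multiple below c would be j + 1 elements.
  Nδ≤conductor⇒multiples : N ∈Γ Γ → N * δ Γ ≤ conductor Γ → MultiplesBelowConductor Γ N
  Nδ≤conductor⇒multiples N∈Γ Nδ≤c = divides j c≡jN , below
    where
    j = conductor Γ / N
    δ≤j : δ Γ ≤ j
    δ≤j = subst (_≤ j) (m*n/n≡m (δ Γ) N) (/-monoˡ-≤ N (subst (_≤ conductor Γ) (*-comm N (δ Γ)) Nδ≤c))
    multiples : ∀ i → (i * N) ∈Γ Γ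
    multiples = ∈Γ-* Γ N∈Γ
    c≡r+jN : conductor Γ ≡ conductor Γ % N + j * N
    c≡r+jN = m≡m%n+[m/n]*n (conductor Γ) N
    r≡0 : conductor Γ % N ≡ 0
    r≡0 with conductor Γ % N in r≡
    ... | zero = refl
    ... | suc _ = ⊥-elim (<⇒≱ (countBelow-multiples-> N (mem Γ) multiples jN<c) δ≤j)
      where
      jN<c : j * N < conductor Γ
      jN<c = subst (j * N <_) (sym (trans c≡r+jN (cong (_+ j * N) r≡))) (m<n+m (j * N) (s≤s z≤n))
    c≡jN : conductor Γ ≡ j * N
    c≡jN = trans c≡r+jN (cong (_+ j * N) r≡0)
    below : ∀ {x} → x < conductor Γ → x ∈Γ Γ → N ∣ x
    below {x} x<c x∈Γ with N ∣? x
    ... | yes N∣x = N∣x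
    ... | no N∤x = ⊥-elim (<⇒≱ (subst (λ c → suc j ≤ countBelow (mem Γ) c) (sym c≡jN)
            (countBelow-multiples-nonmultiple N (mem Γ) multiples j (subst (x <_) c≡jN x<c) x∈Γ N∤x)) δ≤j)

module _ (N : ℕ) .{{_ : NonZero N}} (q : ℕ) where

  arfGens-above : ∀ {n} → q * N ≤ n → InGen (arfGens N q) n
  arfGens-above qN≤n with m≤n⇒∃[o]m+o≡n qN≤n
  ... | d , refl with d % N | m≡m%n+[m/n]*n d N | m%n<n d N
  ...   | zero | d≡ | _ = subst (InGen (arfGens N q)) multiple (InGen-* (here refl) (q + d / N))
    where
    multiple : (q + d / N) * N ≡ q * N + d
    multiple = trans (*-distribʳ-+ N q (d / N)) (cong (λ z → q * N + z) (sym d≡))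
  ...   | suc r | d≡ | 1+r<N = subst (InGen (arfGens N q)) regroup
          (InGen-+ (InGen-generator (there (∈-map⁺ (λ i → q * N + suc i)
                                              (∈-upTo⁺ (∸-monoˡ-< 1+r<N (s≤s z≤n))))))
                   (InGen-* (here refl) (d / N)))
    where
    regroup : q * N + suc r + d / N * N ≡ q * N + d
    regroup = trans (+-assoc (q * N) (suc r) _) (cong (λ z → q * N + z) (sym d≡))

  arfGens-below : ∀ {n} → InGen (arfGens N q) n → n < q * N → N ∣ n
  arfGens-below gen-zero _ = N ∣0
  arfGens-below (gen-step {n = n} (here refl) n∈) N+n<qN =
    ∣m∣n⇒∣m+n ∣-refl (arfGens-below n∈ (≤-<-trans (m≤n+m n N) N+n<qN))
  arfGens-below (gen-step {n = n} (there g∈) _) g+n<qN with ∈-map⁻ (λ i → q * N + suc i) g∈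
  ... | i , _ , refl = ⊥-elim (<⇒≱ g+n<qN (≤-trans (m≤m+n (q * N) (suc i)) (m≤m+n _ n)))

  ≐arfGens-intro : ∀ Γ → N ∈Γ Γ → (∀ {x} → x < q * N → x ∈Γ Γ → N ∣ x) →
                   (∀ {x} → q * N ≤ x → x ∈Γ Γ) → Γ ≐⟨ arfGens N q ⟩
  ≐arfGens-intro Γ N∈Γ below above n = Γ⊆ , InGen⇒∈Γ Γ gens⊆Γ
    where
    gens⊆Γ : ∀ {g} → g ∈ arfGens N q → g ∈Γ Γ
    gens⊆Γ (here refl) = N∈Γ
    gens⊆Γ (there g∈) with ∈-map⁻ (λ i → q * N + suc i) g∈
    ... | i , _ , refl = above (m≤m+n (q * N) (suc i))
    Γ⊆ : n ∈Γ Γ → InGen (arfGens N q) n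
    Γ⊆ n∈Γ with n <? q * N
    ... | no n≮qN = arfGens-above (≮⇒≥ n≮qN)
    ... | yes n<qN with below n<qN n∈Γ
    ...   | divides t n≡tN = subst (InGen (arfGens N q)) (sym n≡tN) (InGen-* (here refl) t)

  ≐arfGens⇒multiples : ∀ Γ → Γ ≐⟨ arfGens N q ⟩ → MultiplesBelowConductor Γ N
  ≐arfGens⇒multiples Γ Γ≐arf = N∣c , λ x<c x∈Γ → below (<-≤-trans x<c c≤qN) x∈Γ
    where
    below : ∀ {x} → x < q * N → x ∈Γ Γ → N ∣ x
    below {x} x<qN x∈Γ = arfGens-below (proj₁ (Γ≐arf x) x∈Γ) x<qN
    c≤qN : conductor Γ ≤ q * N
    c≤qN = conductor-least Γ λ x qN≤x → proj₂ (Γ≐arf x) (arfGens-above qN≤x)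
    N∣c : N ∣ conductor Γ
    N∣c with m≤n⇒m<n∨m≡n c≤qN
    ... | inj₁ c<qN = below c<qN (conductor-≤⇒∈Γ Γ ≤-refl)
    ... | inj₂ c≡qN = subst (N ∣_) (sym c≡qN) (n∣m*n q)

multiples⇒≐arfGens : ∀ Γ → MultiplesBelowConductor Γ (multiplicity Γ) →
                     ∃ λ q → 1 ≤ q × Γ ≐⟨ arfGens (multiplicity Γ) q ⟩
multiples⇒≐arfGens Γ (divides zero c≡0 , _) =
  1 , ≤-refl , ≐arfGens-intro m 1 Γ (multiplicity-∈Γ Γ)
    (λ x<m x∈Γ → subst (m ∣_) (sym (<multiplicity⇒≡0 Γ (subst (_ <_) (+-identityʳ m) x<m) x∈Γ)) (m ∣0))
    (λ {x} _ → conductor≡0⇒whole Γ c≡0 x)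
  where
  m = multiplicity Γ
  instance _ = multiplicity-nonZero Γ
multiples⇒≐arfGens Γ (divides (suc t) c≡ , below) =
  suc t , s≤s z≤n , ≐arfGens-intro m (suc t) Γ (multiplicity-∈Γ Γ)
    (λ x<qm → below (subst (_ <_) (sym c≡) x<qm))
    (λ qm≤x → conductor-≤⇒∈Γ Γ (subst (_≤ _) (sym c≡) qm≤x))
  where
  m = multiplicity Γ
  instance _ = multiplicity-nonZero Γ

arf⇔W≤0 : ∀ Γ → (∃ λ q → 1 ≤ q × Γ ≐⟨ arfGens (multiplicity Γ) q ⟩)
                 ⇔ (∀ k → 1 ≤ k → k ≤ multiplicity Γ → W Γ k ≤ℤ + 0)
arf⇔W≤0 Γ = mk⇔
  (λ (q , _ , Γ≐arf) k _ k≤m → Equivalence.from (W≤0⇔kδ≤conductor Γ k)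
     (≤-trans (*-monoˡ-≤ (δ Γ) k≤m) (multiples⇒Nδ≤conductor Γ (≐arfGens⇒multiples m q Γ Γ≐arf))))
  (λ W≤0 → multiples⇒≐arfGens Γ (Nδ≤conductor⇒multiples Γ (multiplicity-∈Γ Γ)
     (Equivalence.to (W≤0⇔kδ≤conductor Γ m) (W≤0 m (multiplicity-pos Γ) ≤-refl))))
  where
  m = multiplicity Γ
  instance _ = multiplicity-nonZero Γ

Decomposes : NumericalSemigroup → ℕ → Set
Decomposes Γ n = ∃ λ x → 1 ≤ x × x < n × x ∈Γ Γ × (n ∸ x) ∈Γ Γ

splitsUpTo-sound : ∀ Γ n k → splitsUpTo Γ n k ≡ true →
                   ∃ λ x → 1 ≤ x × x ≤ k × x ∈Γ Γ × (n ∸ x) ∈Γ Γ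
splitsUpTo-sound Γ n (suc k) split with mem Γ (suc k) in k∈Γ | mem Γ (n ∸ suc k) in rest∈Γ
... | true | true = suc k , s≤s z≤n , ≤-refl , k∈Γ , rest∈Γ
... | true | false with splitsUpTo-sound Γ n k split
...   | x , 1≤x , x≤k , x∈Γ , r = x , 1≤x , m≤n⇒m≤1+n x≤k , x∈Γ , r
splitsUpTo-sound Γ n (suc k) split | false | _ with splitsUpTo-sound Γ n k split
...   | x , 1≤x , x≤k , x∈Γ , r = x , 1≤x , m≤n⇒m≤1+n x≤k , x∈Γ , r

splitsUpTo-complete : ∀ Γ n k {x} → 1 ≤ x → x ≤ k → x ∈Γ Γ → (n ∸ x) ∈Γ Γ →
                      splitsUpTo Γ n k ≡ true
splitsUpTo-complete Γ n zero {zero} () _ _ _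
splitsUpTo-complete Γ n zero {suc x} _ () _ _
splitsUpTo-complete Γ n (suc k) {x} 1≤x x≤1+k x∈Γ rest∈Γ with m≤n⇒m<n∨m≡n x≤1+k
... | inj₂ refl rewrite x∈Γ | rest∈Γ = refl
... | inj₁ x<1+k with splitsUpTo-complete Γ n k 1≤x (≤-pred x<1+k) x∈Γ rest∈Γ
...   | split with mem Γ (suc k) | mem Γ (n ∸ suc k)
...     | true  | true  = refl
...     | true  | false = split
...     | false | _     = split

isMinGen⇒∈Γ : ∀ Γ {n} → isMinGen Γ n ≡ true → 1 ≤ n × n ∈Γ Γ
isMinGen⇒∈Γ Γ {suc n} minGen with mem Γ (suc n)
... | true = s≤s z≤n , refl

isMinGen⇒¬Decomposes : ∀ Γ {n} → isMinGen Γ n ≡ true → ¬ Decomposes Γ n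
isMinGen⇒¬Decomposes Γ {suc n} minGen (x , 1≤x , x<n , x∈Γ , rest∈Γ)
  with mem Γ (suc n) | splitsUpTo-complete Γ (suc n) n 1≤x (≤-pred x<n) x∈Γ rest∈Γ
... | true | split rewrite split with () ← minGen

isMinGen-intro : ∀ Γ {n} → 1 ≤ n → n ∈Γ Γ → ¬ Decomposes Γ n → isMinGen Γ n ≡ true
isMinGen-intro Γ {suc n} _ n∈Γ indecomposable rewrite n∈Γ with splitsUpTo Γ (suc n) n in split
... | false = refl
... | true with splitsUpTo-sound Γ (suc n) n split
...   | x , 1≤x , x≤n , x∈Γ , rest∈Γ = ⊥-elim (indecomposable (x , 1≤x , s≤s x≤n , x∈Γ , rest∈Γ))

¬isMinGen⇒Decomposes : ∀ Γ {n} → 1 ≤ n → n ∈Γ Γ → isMinGen Γ n ≡ false → Decomposes Γ n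
¬isMinGen⇒Decomposes Γ {suc n} _ n∈Γ notMinGen rewrite n∈Γ with splitsUpTo Γ (suc n) n in split
... | true with splitsUpTo-sound Γ (suc n) n split
...   | x , 1≤x , x≤n , x∈Γ , rest∈Γ = x , 1≤x , s≤s x≤n , x∈Γ , rest∈Γ
¬isMinGen⇒Decomposes Γ {suc n} _ n∈Γ () | false

minGens-generate : ∀ Γ {gs} → (∀ {x} → isMinGen Γ x ≡ true → x ∈ gs) →
                   ∀ {x} → x ∈Γ Γ → InGen gs x
minGens-generate Γ {gs} minGens∈gs {x} = <-rec (λ x → x ∈Γ Γ → InGen gs x) step x
  where
  step : ∀ x → (∀ {y} → y < x → y ∈Γ Γ → InGen gs y) → x ∈Γ Γ → InGen gs x
  step zero _ _ = gen-zero
  step (suc x) rec x∈Γ with isMinGen Γ (suc x) in minGen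
  ... | true = InGen-generator (minGens∈gs minGen)
  ... | false with ¬isMinGen⇒Decomposes Γ (s≤s z≤n) x∈Γ minGen
  ...   | y , 1≤y , y<x , y∈Γ , rest∈Γ = subst (InGen gs) (m+[n∸m]≡n (<⇒≤ y<x))
          (InGen-+ (rec y<x y∈Γ) (rec (∸-monoʳ-< {suc x} {y} {0} 1≤y (<⇒≤ y<x)) rest∈Γ))

minGen∈generators : ∀ Γ {gs} → Γ ≐⟨ gs ⟩ → ∀ {x} → isMinGen Γ x ≡ true → x ∈ gs
minGen∈generators Γ {gs} Γ≐gs {x} minGen = go (proj₁ (Γ≐gs x) (proj₂ (isMinGen⇒∈Γ Γ minGen))) minGen
  where
  go : ∀ {x} → InGen gs x → isMinGen Γ x ≡ true → x ∈ gs
  go (gen-step {g} {n} g∈gs n∈) minGen with n ≟ 0 | g ≟ 0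
  ... | yes refl | _ = subst (_∈ gs) (sym (+-identityʳ g)) g∈gs
  ... | no _ | yes refl = go n∈ minGen
  ... | no n≢0 | no g≢0 = ⊥-elim (isMinGen⇒¬Decomposes Γ minGen
          (g , n≢0⇒n>0 g≢0 , m<m+n g (n≢0⇒n>0 n≢0) , proj₂ (Γ≐gs g) (InGen-generator g∈gs)
             , subst (_∈Γ Γ) (sym (m+n∸m≡n g n)) (proj₂ (Γ≐gs n) n∈)))

multiplicity-isMinGen : ∀ Γ → isMinGen Γ (multiplicity Γ) ≡ true
multiplicity-isMinGen Γ = isMinGen-intro Γ (multiplicity-pos Γ) (multiplicity-∈Γ Γ)
  λ (x , 1≤x , x<m , x∈Γ , _) → <⇒≱ x<m (multiplicity-≤ Γ 1≤x x∈Γ)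

isMinGen⇒<conductor+multiplicity : ∀ Γ {x} → 1 ≤ conductor Γ → isMinGen Γ x ≡ true →
                                   x < conductor Γ + multiplicity Γ
isMinGen⇒<conductor+multiplicity Γ {x} 1≤c minGen = ≰⇒> λ c+m≤x →
  isMinGen⇒¬Decomposes Γ minGen
    ( multiplicity Γ , multiplicity-pos Γ , <-≤-trans (m<n+m _ 1≤c) c+m≤x , multiplicity-∈Γ Γ
    , conductor-≤⇒∈Γ Γ (subst (_≤ x ∸ multiplicity Γ) (m+n∸n≡m (conductor Γ) (multiplicity Γ))
                               (∸-monoˡ-≤ (multiplicity Γ) c+m≤x)))

otherMinGens : NumericalSemigroup → ℕ → Bool
otherMinGens Γ = remove (isMinGen Γ) (multiplicity Γ)

embeddingDimension≡1+other : ∀ Γ → ¬ IsWhole Γ →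
  embeddingDimension Γ ≡ suc (countBelow (otherMinGens Γ) (conductor Γ + multiplicity Γ))
embeddingDimension≡1+other Γ ¬whole =
  countBelow-remove (isMinGen Γ) (m<n+m _ (¬whole⇒1≤conductor Γ ¬whole)) (multiplicity-isMinGen Γ)

¬whole⇒1≤otherMinGens : ∀ Γ → ¬ IsWhole Γ →
                        1 ≤ countBelow (otherMinGens Γ) (conductor Γ + multiplicity Γ)
¬whole⇒1≤otherMinGens Γ ¬whole with countBelow (otherMinGens Γ) (conductor Γ + multiplicity Γ) in none
... | suc _ = s≤s z≤n
... | zero = ⊥-elim (<⇒≢ (¬whole⇒2≤multiplicity Γ ¬whole) (sym (∣1⇒≡1 m∣1)))
  where
  onlyMultiplicity : ∀ {x} → isMinGen Γ x ≡ true → x ∈ multiplicity Γ ∷ []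
  onlyMultiplicity minGen = here (countBelow-remove≡0 (isMinGen Γ) (multiplicity Γ) _ none
    (isMinGen⇒<conductor+multiplicity Γ (¬whole⇒1≤conductor Γ ¬whole) minGen) minGen)
  m∣1 : multiplicity Γ ∣ 1
  m∣1 = ∣generators⇒∣1 Γ (minGens-generate Γ onlyMultiplicity) λ { (here refl) → ∣-refl }

¬whole⇒2≤embeddingDimension : ∀ Γ → ¬ IsWhole Γ → 2 ≤ embeddingDimension Γ
¬whole⇒2≤embeddingDimension Γ ¬whole =
  subst (2 ≤_) (sym (embeddingDimension≡1+other Γ ¬whole)) (s≤s (¬whole⇒1≤otherMinGens Γ ¬whole))

embeddingDimension≤2⇒minGens : ∀ Γ → ¬ IsWhole Γ → embeddingDimension Γ ≤ 2 →
  ∃ λ b → isMinGen Γ b ≡ true × (∀ {x} → isMinGen Γ x ≡ true → x ∈ multiplicity Γ ∷ b ∷ [])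
embeddingDimension≤2⇒minGens Γ ¬whole e≤2
  with countBelow-witness (otherMinGens Γ) (conductor Γ + multiplicity Γ) (¬whole⇒1≤otherMinGens Γ ¬whole)
... | b , b<n , other-b = b , proj₂ (remove-true (isMinGen Γ) {multiplicity Γ} {b} other-b) , onlyMB
  where
  none : countBelow (remove (otherMinGens Γ) b) (conductor Γ + multiplicity Γ) ≡ 0
  none = n≤0⇒n≡0 (≤-pred (≤-pred (subst (_≤ 2)
    (trans (embeddingDimension≡1+other Γ ¬whole) (cong suc (countBelow-remove (otherMinGens Γ) b<n other-b)))
    e≤2)))
  onlyMB : ∀ {x} → isMinGen Γ x ≡ true → x ∈ multiplicity Γ ∷ b ∷ []
  onlyMB {x} minGen with x ≟ multiplicity Γ
  ... | yes x≡m = here x≡m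
  ... | no x≢m = there (here (countBelow-remove≡0 (otherMinGens Γ) b _ none
          (isMinGen⇒<conductor+multiplicity Γ (¬whole⇒1≤conductor Γ ¬whole) minGen)
          (trans (remove-other (isMinGen Γ) x≢m) minGen)))

twoMinGens⇒twoGenerated : ∀ Γ → ¬ IsWhole Γ → ∀ {b} → isMinGen Γ b ≡ true →
  (∀ {x} → isMinGen Γ x ≡ true → x ∈ multiplicity Γ ∷ b ∷ []) →
  ∃₂ λ a b → 2 ≤ a × 2 ≤ b × gcd a b ≡ 1 × Γ ≐⟨ a ∷ b ∷ [] ⟩
twoMinGens⇒twoGenerated Γ ¬whole {b} b-isMinGen onlyMB =
  m , b , 2≤m , ≤-trans 2≤m (multiplicity-≤ Γ 1≤b b∈Γ) , gcd≡1 , λ _ → Γ⊆ , InGen⇒∈Γ Γ gens⊆Γ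
  where
  m = multiplicity Γ
  2≤m : 2 ≤ m
  2≤m = ¬whole⇒2≤multiplicity Γ ¬whole
  1≤b : 1 ≤ b
  1≤b = proj₁ (isMinGen⇒∈Γ Γ b-isMinGen)
  b∈Γ : b ∈Γ Γ
  b∈Γ = proj₂ (isMinGen⇒∈Γ Γ b-isMinGen)
  Γ⊆ : ∀ {x} → x ∈Γ Γ → InGen (m ∷ b ∷ []) x
  Γ⊆ = minGens-generate Γ onlyMB
  gens⊆Γ : ∀ {g} → g ∈ m ∷ b ∷ [] → g ∈Γ Γ
  gens⊆Γ (here refl) = multiplicity-∈Γ Γ
  gens⊆Γ (there (here refl)) = b∈Γ
  gcd≡1 : gcd m b ≡ 1
  gcd≡1 = ∣1⇒≡1 (∣generators⇒∣1 Γ Γ⊆ λ { (here refl) → gcd[m,n]∣m m b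
                                        ; (there (here refl)) → gcd[m,n]∣n m b })

Representable : ℕ → ℕ → ℕ → Set
Representable a b n = ∃₂ λ i j → n ≡ i * a + j * b

frobenius-exists : ∀ {a b} → 2 ≤ a → 2 ≤ b → ∃ λ f → f + a + b ≡ a * b
frobenius-exists {suc (suc a)} {suc (suc b)} (s≤s (s≤s _)) (s≤s (s≤s _)) = a + b + a * b , identity a b
  where
  identity : ∀ a b → (a + b + a * b) + (2 + a) + (2 + b) ≡ (2 + a) * (2 + b)
  identity = solve-∀

frobenius-unrepresentable : ∀ {a b f} → 1 ≤ b → Coprime a b → f + a + b ≡ a * b → ¬ Representable a b f
frobenius-unrepresentable {a} {b} {f} 1≤b coprime f+a+b≡ab (i , j , f≡) = <-irrefl refl ab<ab
  where
  ab≡ : suc j * b + suc i * a ≡ a * b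
  ab≡ = trans (shift a b i j) (trans (cong (λ z → z + a + b) (sym f≡)) f+a+b≡ab)
    where
    shift : ∀ a b i j → suc j * b + suc i * a ≡ i * a + j * b + a + b
    shift = solve-∀
  b∣1+i : b ∣ suc i
  b∣1+i = coprime-divisor (Data.Nat.Coprimality.sym coprime) (subst (b ∣_) (*-comm (suc i) a)
            (∣m+n∣m⇒∣n (subst (b ∣_) (sym ab≡) (n∣m*n a)) (n∣m*n (suc j))))
  ab<ab : a * b < a * b
  ab<ab = begin-strict
    a * b                 ≡⟨ *-comm a b ⟩
    b * a                 ≤⟨ *-monoˡ-≤ a (∣⇒≤ b∣1+i) ⟩
    suc i * a             <⟨ m<n+m (suc i * a) (≤-trans 1≤b (m≤m+n b (j * b))) ⟩
    suc j * b + suc i * a ≡⟨ ab≡ ⟩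
    a * b                 ∎
    where open ≤-Reasoning

modInverse : ∀ {a b} → 2 ≤ b → Coprime a b → ∃₂ λ x y → 1 + y * b ≡ x * a
modInverse {a} {b} 2≤b coprime with coprime-Bézout coprime
... | Bézout.+- x y eq = x , y , eq
modInverse {a} {suc (suc c)} (s≤s (s≤s _)) coprime | Bézout.-+ x (suc y) eq =
  suc c * x , suc c * y + c , +-cancelˡ-≡ (suc c) _ _ (begin
    suc c + (1 + (suc c * y + c) * b) ≡⟨ expand₁ c y ⟩
    suc c * (suc y * b)               ≡⟨ cong (suc c *_) eq ⟨
    suc c * (1 + x * a)               ≡⟨ expand₂ c x a ⟩
    suc c + suc c * x * a             ∎)
  where
  open ≡-Reasoning
  b = suc (suc c)
  expand₁ : ∀ c y → suc c + (1 + (suc c * y + c) * (2 + c)) ≡ suc c * ((1 + y) * (2 + c))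
  expand₁ = solve-∀
  expand₂ : ∀ c x a → suc c * (1 + x * a) ≡ suc c + suc c * x * a
  expand₂ = solve-∀

residue : ∀ {a b} .{{_ : NonZero b}} → (∃₂ λ x y → 1 + y * b ≡ x * a) → ∀ n →
          ∃ λ i → i < b × ∃₂ λ P Q → i * a + P * b ≡ n + Q * b
residue {a} {b} (x , y , inverse) n =
  (n * x) % b , m%n<n (n * x) b , (n * x) / b * a , n * y , (begin
    (n * x) % b * a + (n * x) / b * a * b ≡⟨ regroup ((n * x) % b) ((n * x) / b) a b ⟩
    ((n * x) % b + (n * x) / b * b) * a   ≡⟨ cong (_* a) (m≡m%n+[m/n]*n (n * x) b) ⟨
    n * x * a                             ≡⟨ *-assoc n x a ⟩
    n * (x * a)                           ≡⟨ cong (n *_) inverse ⟨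
    n * (1 + y * b)                       ≡⟨ expand n y b ⟩
    n + n * y * b                         ∎)
  where
  open ≡-Reasoning
  regroup : ∀ i t a b → i * a + t * a * b ≡ (i + t * b) * a
  regroup = solve-∀
  expand : ∀ n y b → n * (1 + y * b) ≡ n + n * y * b
  expand = solve-∀

-- From i a ≡ n (mod b) with i < b: either n = i a + d b with d ≥ 0, or n = i a − (d + 1) b
-- and then n + (b − 1 − i) a + d b = (b − 1) a − b = f.
congruence-dichotomy : ∀ {a b f n i P Q} → f + a + b ≡ a * b → i < b → i * a + P * b ≡ n + Q * b →
  Representable a b n ⊎ ∃ λ m → Representable a b m × n + m ≡ f
congruence-dichotomy {a} {b} {f} {n} {i} {P} {Q} f+a+b≡ab i<b eq with Q ≤? P
... | yes Q≤P with m≤n⇒∃[o]m+o≡n Q≤P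
...   | d , refl = inj₁ (i , d , +-cancelʳ-≡ (Q * b) n (i * a + d * b) (trans (sym eq) (shift i a Q d b)))
  where
  shift : ∀ i a Q d b → i * a + (Q + d) * b ≡ i * a + d * b + Q * b
  shift = solve-∀
congruence-dichotomy {a} {b} {f} {n} {i} {P} {Q} f+a+b≡ab i<b eq | no Q≰P
  with m≤n⇒∃[o]m+o≡n (≰⇒> Q≰P) | m≤n⇒∃[o]m+o≡n i<b
... | k , refl | r , refl = inj₂ (r * a + k * b , (r , k , refl) , +-cancelʳ-≡ (a + b + P * b) _ f (begin
    n + (r * a + k * b) + (a + b + P * b) ≡⟨ regroup₁ n r a k P (suc i + r) ⟩
    n + (suc P + k) * b + (r * a + a)     ≡⟨ cong (_+ (r * a + a)) eq ⟨
    i * a + P * b + (r * a + a)           ≡⟨ regroup₂ i a P r ⟩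
    a * b + P * b                         ≡⟨ cong (_+ P * b) f+a+b≡ab ⟨
    f + a + b + P * b                     ≡⟨ regroup₃ f a b (P * b) ⟩
    f + (a + b + P * b)                   ∎))
  where
  open ≡-Reasoning
  regroup₁ : ∀ n r a k P b → n + (r * a + k * b) + (a + b + P * b) ≡ n + (suc P + k) * b + (r * a + a)
  regroup₁ = solve-∀
  regroup₂ : ∀ i a P r → i * a + P * (suc i + r) + (r * a + a) ≡ a * (suc i + r) + P * (suc i + r)
  regroup₂ = solve-∀
  regroup₃ : ∀ f a b c → f + a + b + c ≡ f + (a + b + c)
  regroup₃ = solve-∀

representable⊎dual : ∀ {a b f} → 2 ≤ b → Coprime a b → f + a + b ≡ a * b → ∀ n →
  Representable a b n ⊎ ∃ λ m → Representable a b m × n + m ≡ f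
representable⊎dual 2≤b@(s≤s (s≤s _)) coprime f+a+b≡ab n
  with residue (modInverse 2≤b coprime) n
... | i , i<b , P , Q , eq = congruence-dichotomy {P = P} {Q} f+a+b≡ab i<b eq

symmetric⇒2δ≡conductor : ∀ Γ {f} → conductor Γ ≡ suc f →
  (∀ x → x < suc f → mem Γ (f ∸ x) ≡ not (mem Γ x)) → 2 * δ Γ ≡ conductor Γ
symmetric⇒2δ≡conductor Γ {f} c≡1+f symmetric = begin
  2 * δ Γ                                      ≡⟨ cong (λ c → 2 * countBelow (mem Γ) c) c≡1+f ⟩
  2 * D                                        ≡⟨ cong (λ z → D + z) (+-identityʳ D) ⟩
  D + D                                        ≡⟨ cong (λ z → D + z) (countBelow-reverse (mem Γ) (suc f)) ⟩
  D + countBelow (λ x → mem Γ (f ∸ x)) (suc f) ≡⟨ cong (λ z → D + z) (countBelow-cong _ _ (suc f) symmetric) ⟩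
  D + countBelow (λ x → not (mem Γ x)) (suc f) ≡⟨ countBelow-not (mem Γ) (suc f) ⟩
  suc f                                        ≡⟨ c≡1+f ⟨
  conductor Γ                                  ∎
  where
  open ≡-Reasoning
  D = countBelow (mem Γ) (suc f)

module TwoGenerated {Γ a b f} (2≤b : 2 ≤ b) (coprime : Coprime a b) (f+a+b≡ab : f + a + b ≡ a * b)
                    (Γ≐ab : Γ ≐⟨ a ∷ b ∷ [] ⟩) where

  representable⇒∈Γ : ∀ {n} → Representable a b n → n ∈Γ Γ
  representable⇒∈Γ (i , j , refl) =
    proj₂ (Γ≐ab _) (InGen-+ (InGen-* (here refl) i) (InGen-* (there (here refl)) j))

  ∈Γ⇒representable : ∀ {n} → n ∈Γ Γ → Representable a b n
  ∈Γ⇒representable {n} n∈Γ = fromInGen (proj₁ (Γ≐ab n) n∈Γ)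
    where
    fromInGen : ∀ {n} → InGen (a ∷ b ∷ []) n → Representable a b n
    fromInGen gen-zero = 0 , 0 , refl
    fromInGen (gen-step (here refl) n∈) with fromInGen n∈
    ... | i , j , refl = suc i , j , sym (+-assoc a (i * a) (j * b))
    fromInGen (gen-step (there (here refl)) n∈) with fromInGen n∈
    ... | i , j , refl = i , suc j , swap b (i * a) (j * b)
      where
      swap : ∀ x y z → x + (y + z) ≡ y + (x + z)
      swap = solve-∀

  f∉Γ : mem Γ f ≡ false
  f∉Γ with mem Γ f in f∈Γ
  ... | false = refl
  ... | true = ⊥-elim (frobenius-unrepresentable (<⇒≤ 2≤b) coprime f+a+b≡ab (∈Γ⇒representable f∈Γ))

  ¬whole : ¬ IsWhole Γ
  ¬whole whole with () ← trans (sym f∉Γ) (whole f)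

  >f⇒∈Γ : ∀ x → suc f ≤ x → x ∈Γ Γ
  >f⇒∈Γ x f<x with representable⊎dual 2≤b coprime f+a+b≡ab x
  ... | inj₁ x-rep = representable⇒∈Γ x-rep
  ... | inj₂ (m , _ , x+m≡f) = ⊥-elim (<⇒≱ f<x (subst (x ≤_) x+m≡f (m≤m+n x m)))

  symmetric : ∀ x → x < suc f → mem Γ (f ∸ x) ≡ not (mem Γ x)
  symmetric x x<1+f with mem Γ x in x∈Γ
  ... | true with mem Γ (f ∸ x) in rest∈Γ
  ...   | false = refl
  ...   | true with () ← trans (sym f∉Γ)
                          (subst (_∈Γ Γ) (m+[n∸m]≡n (≤-pred x<1+f)) (mem-add Γ x _ x∈Γ rest∈Γ))
  symmetric x x<1+f | false with representable⊎dual 2≤b coprime f+a+b≡ab x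
  ... | inj₁ x-rep with () ← trans (sym x∈Γ) (representable⇒∈Γ x-rep)
  ... | inj₂ (m , m-rep , x+m≡f) =
    subst (_∈Γ Γ) (trans (sym (m+n∸m≡n x m)) (cong (_∸ x) x+m≡f)) (representable⇒∈Γ m-rep)

  2δ≡conductor : 2 * δ Γ ≡ conductor Γ
  2δ≡conductor = symmetric⇒2δ≡conductor Γ (conductor-≡ Γ >f⇒∈Γ f∉Γ) symmetric

  embeddingDimension≤2 : embeddingDimension Γ ≤ 2
  embeddingDimension≤2 = countBelow-≤2 (isMinGen Γ) a b (conductor Γ + multiplicity Γ)
                           λ _ _ minGen → pair (minGen∈generators Γ Γ≐ab minGen)
    where
    pair : ∀ {x} → x ∈ a ∷ b ∷ [] → x ≡ a ⊎ x ≡ b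
    pair (here x≡a) = inj₁ x≡a
    pair (there (here x≡b)) = inj₂ x≡b

WilfBalanced : NumericalSemigroup → Set
WilfBalanced Δ = ¬ IsWhole Δ × (∀ k → 2 ≤ k → k ≤ multiplicity Δ → + 0 ≤ℤ W Δ k) × W Δ 2 ≡ + 0

ℕ∖1 : NumericalSemigroup
ℕ∖1 = record { mem = mem₀ ; mem-zero = refl ; mem-add = add ; bound = 2 ; mem-above = above }
  where
  mem₀ : ℕ → Bool
  mem₀ 1 = false
  mem₀ _ = true
  add : ∀ x y → mem₀ x ≡ true → mem₀ y ≡ true → mem₀ (x + y) ≡ true
  add zero y _ y∈ = y∈
  add (suc (suc x)) y _ _ = refl
  above : ∀ n → 2 ≤ n → mem₀ n ≡ true
  above (suc (suc n)) _ = refl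
  above 1 (s≤s ())

ℕ∖1-wilfBalanced : WilfBalanced ℕ∖1
ℕ∖1-wilfBalanced =
  (λ whole → 1∉ (whole 1)) ,
  (λ k 2≤k _ → Equivalence.from (0≤W⇔conductor≤kδ ℕ∖1 k) (subst (2 ≤_) (sym (*-identityʳ k)) 2≤k)) ,
  refl
  where
  1∉ : false ≢ true
  1∉ ()

minimallyEmbedded⇔twoGenerated : ∀ Γ →
  (WilfBalanced Γ × (∀ Δ → WilfBalanced Δ → embeddingDimension Γ ≤ embeddingDimension Δ))
  ⇔ (∃₂ λ a b → 2 ≤ a × 2 ≤ b × gcd a b ≡ 1 × Γ ≐⟨ a ∷ b ∷ [] ⟩)
minimallyEmbedded⇔twoGenerated Γ = mk⇔ minimal⇒twoGenerated twoGenerated⇒minimal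
  where
  Minimal : Set
  Minimal = ∀ Δ → WilfBalanced Δ → embeddingDimension Γ ≤ embeddingDimension Δ
  CoprimeTwoGenerated : Set
  CoprimeTwoGenerated = ∃₂ λ a b → 2 ≤ a × 2 ≤ b × gcd a b ≡ 1 × Γ ≐⟨ a ∷ b ∷ [] ⟩
  minimal⇒twoGenerated : WilfBalanced Γ × Minimal → CoprimeTwoGenerated
  minimal⇒twoGenerated ((¬whole , _ , _) , minimal)
    with embeddingDimension≤2⇒minGens Γ ¬whole (minimal ℕ∖1 ℕ∖1-wilfBalanced)
  ... | b , b-isMinGen , onlyMB = twoMinGens⇒twoGenerated Γ ¬whole b-isMinGen onlyMB
  twoGenerated⇒minimal : CoprimeTwoGenerated → WilfBalanced Γ × Minimal
  twoGenerated⇒minimal (a , b , 2≤a , 2≤b , gcd≡1 , Γ≐ab) with frobenius-exists 2≤a 2≤b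
  ... | f , f+a+b≡ab =
    ( ¬whole
    , (λ k 2≤k _ → Equivalence.from (0≤W⇔conductor≤kδ Γ k)
                     (subst (_≤ k * δ Γ) 2δ≡conductor (*-monoˡ-≤ (δ Γ) 2≤k)))
    , i≡j⇒i-j≡0 (cong +_ 2δ≡conductor) )
    , λ Δ (¬wholeΔ , _) → ≤-trans embeddingDimension≤2 (¬whole⇒2≤embeddingDimension Δ ¬wholeΔ)
    where open TwoGenerated {Γ} {f = f} 2≤b (gcd≡1⇒coprime gcd≡1) f+a+b≡ab Γ≐ab

theorem3p8 :
  (∀ (Γ : NumericalSemigroup) →
    (IsWhole Γ ⇔ (∀ k → 1 ≤ k → k ≤ multiplicity Γ → + 0 ≤ℤ W Γ k)))
  × (∀ (Γ : NumericalSemigroup) →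
    ((∃ λ q → 1 ≤ q × Γ ≐⟨ arfGens (multiplicity Γ) q ⟩)
      ⇔ (∀ k → 1 ≤ k → k ≤ multiplicity Γ → W Γ k ≤ℤ + 0)))
  × (∀ (Γ : NumericalSemigroup) →
    let P : NumericalSemigroup → Set
        P Δ = ¬ IsWhole Δ
              × (∀ k → 2 ≤ k → k ≤ multiplicity Δ → + 0 ≤ℤ W Δ k)
              × W Δ 2 ≡ + 0
    in (P Γ × (∀ Δ → P Δ → embeddingDimension Γ ≤ embeddingDimension Δ))
       ⇔ (∃ λ a → ∃ λ b → 2 ≤ a × 2 ≤ b × gcd a b ≡ 1 × Γ ≐⟨ a ∷ b ∷ [] ⟩))
theorem3p8 = whole⇔0≤W , arf⇔W≤0 , minimallyEmbedded⇔twoGenerated
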